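{- Let $m$ be odd and suppose $B,D\subseteq\mathbb{Z}_m$ are $2$-$\{m;k,r;k+r-\frac{m+1}{2}\}$ ASDS with $0\notin B$ and $m-1\notin D$. Then $\frac{(m-1)^2}{2}\le (k+r)m-(k^2+r^2)\le\frac{m^2-1}{2}$.
   Context: For $B,D\subseteq\mathbb{Z}_m$ and $a\in\mathbb{Z}_m$, $N(a)=|\{(x,x')\in B\times B:x-x'\equiv a\bmod m\}|+|\{(y,y')\in D\times D:y-y'\equiv a\bmod m\}|$. $B,D$ are $2$-$\{m;k_1,k_2;\mu\}$ ASDS if $|B|=k_1$, $|D|=k_2$ and $N(a)\in\{\mu,\mu+1\}$ for every $a\in\mathbb{Z}_m\setminus\{0\}$. -}

module Defs where

open import Data.Nat using (ℕ; zero; suc; _+_; _*_; _∸_; _%_; NonZero)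
open import Data.Fin using (Fin; toℕ)
open import Data.Fin.Subset using (Subset; _∈_; ∣_∣)
open import Data.Fin.Subset.Properties using (_∈?_)
open import Data.List using (List; length; filter; cartesianProduct)
open import Data.List using () renaming (allFin to allFinL)
open import Data.Product using (_×_; _,_)
open import Relation.Nullary using (Dec; yes; no)
open import Relation.Nullary.Decidable using (_×-dec_)
import Data.Nat.Properties as ℕP
open import Relation.Binary.PropositionalEquality using (_≡_)
open import Relation.Nullary using (¬_)
open import Data.Sum using (_⊎_)
open import Data.Integer using (ℤ; +_)
import Data.Integer as ℤ

diffMod : (m : ℕ) → .{{_ : NonZero m}} → Fin m → Fin m → ℕ
diffMod m x x' = (toℕ x + (m ∸ toℕ x')) % m

repCount : (m : ℕ) → .{{_ : NonZero m}} → Subset m → ℕ → ℕ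
repCount m S a =
  length (filter (λ p → let (x , x') = p in
                   ((x ∈? S) ×-dec (x' ∈? S)) ×-dec (diffMod m x x' ℕP.≟ (a % m)))
                 (cartesianProduct (allFinL m) (allFinL m)))

N : (m : ℕ) → .{{_ : NonZero m}} → Subset m → Subset m → ℕ → ℕ
N m B D a = repCount m B a + repCount m D a

IsASDS : (m : ℕ) → .{{_ : NonZero m}} → Subset m → Subset m → ℕ → ℕ → ℤ → Set
IsASDS m B D k₁ k₂ μ =
  ∣ B ∣ ≡ k₁ × ∣ D ∣ ≡ k₂ ×
  ((a : Fin m) → ¬ (toℕ a ≡ 0) →
     (+ N m B D (toℕ a) ≡ μ) ⊎ (+ N m B D (toℕ a) ≡ μ ℤ.+ + 1))

-- Counting the ordered pairs of B × B and of D × D by their difference gives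
-- Σ_{a ∈ ℤ_m} N(a) = k² + r², and the pairs with difference 0 give N(0) = k + r.  So the m − 1 values N(a), a ≠ 0, each equal to μ or
-- μ + 1, add up to k² + r² − k − r, whence (m − 1)μ ≤ k² + r² − k − r ≤ (m − 1)(μ + 1).  With
-- μ = k + r − (m + 1)/2 these two inequalities are, after doubling, exactly the claimed bounds.
module Submission where

open import Data.Bool.Base using (Bool; true; false; _∧_)
open import Data.Bool.Properties using (∧-idem)
open import Data.Fin.Base using (Fin; zero; suc; toℕ)
open import Data.Fin.Properties using (toℕ<n)
open import Data.Fin.Subset using (Subset; inside; outside; _∉_; ∣_∣)
open import Data.Vec.Base using ([]; _∷_)
open import Data.Fin.Subset.Properties using (_∈?_)
open import Data.List.Base using (length; filter; tabulate; cartesianProduct; map; _++_)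
open import Data.List.Properties using (filter-++; length-++; map-tabulate)
open import Data.Nat.Base using (ℕ; zero; suc; NonZero; _%_; _/_; _∸_)
import Data.Nat
open import Data.Nat.Properties using (+-0-commutativeMonoid; +-*-semiring)
open import Data.Product.Base using (_×_; _,_; proj₁; proj₂)
open import Data.Sum.Base using (_⊎_; inj₁; inj₂)
open import Function.Base using (_∘_; id)
open import Function.Bundles using (_⇔_; mk⇔)
open import Relation.Binary.PropositionalEquality
open import Relation.Nullary.Decidable using (does; does-⇔; _×-dec_)
open import Relation.Nullary.Negation using (contradiction)
open import Relation.Unary using (Pred; Decidable)
open import Algebra.Properties.CommutativeMonoid.Sum +-0-commutativeMonoid
  using (sum; sum-syntax; sum-cong-≗; sum-replicate-zero; ∑-comm; ∑-distrib-+)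
open import Algebra.Properties.Semiring.Sum +-*-semiring using (*-distribˡ-sum; *-distribʳ-sum)
open import Defs

module _ where
  open import Data.Nat.Base using (_+_; _*_; _≤_; _<_; _≡ᵇ_; s≤s; >-nonZero⁻¹)
  open import Data.Nat.Properties
  open import Data.Nat.DivMod using (m≡m%n+[m/n]*n; %-distribˡ-+; [m+n]%n≡m%n; m<n⇒m%n≡m; m%n<n)
  open ≡-Reasoning

  𝟙 : Bool → ℕ
  𝟙 true  = 1
  𝟙 false = 0

  𝟙-∧ : ∀ b c → 𝟙 (b ∧ c) ≡ 𝟙 b * 𝟙 c
  𝟙-∧ true  c = sym (+-identityʳ (𝟙 c))
  𝟙-∧ false c = refl

  𝟙-idem : ∀ b → 𝟙 b * 𝟙 b ≡ 𝟙 b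
  𝟙-idem b = trans (sym (𝟙-∧ b b)) (cong 𝟙 (∧-idem b))

  length-filter-tabulate : ∀ {a p} {A : Set a} {P : Pred A p} (P? : Decidable P) {n} (f : Fin n → A) →
    length (filter P? (tabulate f)) ≡ ∑[ i < n ] 𝟙 (does (P? (f i)))
  length-filter-tabulate P? {zero}  f = refl
  length-filter-tabulate P? {suc n} f with does (P? (f zero))
  ... | true  = cong suc (length-filter-tabulate P? (f ∘ suc))
  ... | false = length-filter-tabulate P? (f ∘ suc)

  length-filter-cartesianProduct : ∀ {a b p} {A : Set a} {B : Set b} {P : Pred (A × B) p} (P? : Decidable P) {m n}
    (f : Fin m → A) (g : Fin n → B) →
    length (filter P? (cartesianProduct (tabulate f) (tabulate g)))
      ≡ ∑[ i < m ] ∑[ j < n ] 𝟙 (does (P? (f i , g j)))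
  length-filter-cartesianProduct P? {zero}  f g = refl
  length-filter-cartesianProduct P? {suc m} f g = begin
    length (filter P? (row ++ rest))
      ≡⟨ cong length (filter-++ P? row rest) ⟩
    length (filter P? row ++ filter P? rest)
      ≡⟨ length-++ (filter P? row) ⟩
    length (filter P? row) + length (filter P? rest)
      ≡⟨ cong₂ _+_ (trans (cong (length ∘ filter P?) (map-tabulate g (f zero ,_)))
                          (length-filter-tabulate P? (λ j → f zero , g j)))
                   (length-filter-cartesianProduct P? (f ∘ suc) g) ⟩
    ∑[ j < _ ] 𝟙 (does (P? (f zero , g j))) + ∑[ i < m ] ∑[ j < _ ] 𝟙 (does (P? (f (suc i) , g j)))
      ∎
    where
    row  = map (f zero ,_) (tabulate g)
    rest = cartesianProduct (tabulate (f ∘ suc)) (tabulate g)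

  ∑-𝟙-∈ : ∀ {n} (p : Subset n) → ∑[ i < n ] 𝟙 (does (i ∈? p)) ≡ ∣ p ∣
  ∑-𝟙-∈ []            = refl
  ∑-𝟙-∈ (inside  ∷ p) = cong suc (∑-𝟙-∈ p)
  ∑-𝟙-∈ (outside ∷ p) = ∑-𝟙-∈ p

  ∑-𝟙-≡ᵇ : ∀ {c n} → c < n → ∑[ j < n ] 𝟙 (c ≡ᵇ toℕ j) ≡ 1
  ∑-𝟙-≡ᵇ {zero}  {suc n} _         = cong suc (sum-replicate-zero n)
  ∑-𝟙-≡ᵇ {suc c} {suc n} (s≤s c<n) = ∑-𝟙-≡ᵇ c<n

  ∑-select : ∀ {n} (i : Fin n) (f : Fin n → ℕ) → ∑[ j < n ] (𝟙 (toℕ i ≡ᵇ toℕ j) * f j) ≡ f i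
  ∑-select {suc n} zero    f =
    trans (cong₂ _+_ (+-identityʳ (f zero)) (sum-replicate-zero n)) (+-identityʳ (f zero))
  ∑-select         (suc i) f = ∑-select i (f ∘ suc)

  module _ {m : ℕ} .{{_ : NonZero m}} {x y : Fin m} where

    diffMod-≥ : toℕ y ≤ toℕ x → diffMod m x y ≡ toℕ x ∸ toℕ y
    diffMod-≥ y≤x = begin
      (toℕ x + (m ∸ toℕ y)) % m   ≡⟨ cong (_% m) (sym (+-∸-assoc (toℕ x) (<⇒≤ (toℕ<n y)))) ⟩
      (toℕ x + m ∸ toℕ y) % m     ≡⟨ cong (_% m) (+-∸-comm m y≤x) ⟩
      (toℕ x ∸ toℕ y + m) % m     ≡⟨ [m+n]%n≡m%n (toℕ x ∸ toℕ y) m ⟩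
      (toℕ x ∸ toℕ y) % m         ≡⟨ m<n⇒m%n≡m (≤-<-trans (m∸n≤m (toℕ x) (toℕ y)) (toℕ<n x)) ⟩
      toℕ x ∸ toℕ y               ∎

    diffMod-< : toℕ x < toℕ y → diffMod m x y ≡ toℕ x + (m ∸ toℕ y)
    diffMod-< x<y = m<n⇒m%n≡m
      (<-≤-trans (+-monoˡ-< (m ∸ toℕ y) x<y) (≤-reflexive (m+[n∸m]≡n (<⇒≤ (toℕ<n y)))))

    diffMod≡0⇔ : diffMod m x y ≡ 0 ⇔ toℕ x ≡ toℕ y
    diffMod≡0⇔ = mk⇔ to from
      where
      to : diffMod m x y ≡ 0 → toℕ x ≡ toℕ y
      to d≡0 with ≤-<-connex (toℕ y) (toℕ x)
      ... | inj₁ y≤x = ≤-antisym (m∸n≡0⇒m≤n (trans (sym (diffMod-≥ y≤x)) d≡0)) y≤x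
      ... | inj₂ x<y = contradiction (m∸n≡0⇒m≤n (m+n≡0⇒n≡0 (toℕ x) (trans (sym (diffMod-< x<y)) d≡0)))
                                     (<⇒≱ (toℕ<n y))
      from : toℕ x ≡ toℕ y → diffMod m x y ≡ 0
      from x≡y = trans (diffMod-≥ (≤-reflexive (sym x≡y))) (m≤n⇒m∸n≡0 (≤-reflexive x≡y))

  module _ {m : ℕ} .{{_ : NonZero m}} (S : Subset m) where

    diffIndicator : ℕ → Fin m → Fin m → ℕ
    diffIndicator c x y = 𝟙 (does (x ∈? S)) * 𝟙 (does (y ∈? S)) * 𝟙 (diffMod m x y ≡ᵇ c)

    repCount≡∑∑ : ∀ {c} → c < m → repCount m S c ≡ ∑[ x < m ] ∑[ y < m ] diffIndicator c x y
    repCount≡∑∑ {c} c<m = begin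
      repCount m S c
        ≡⟨ length-filter-cartesianProduct P? id id ⟩
      ∑[ x < m ] ∑[ y < m ] 𝟙 ((does (x ∈? S) ∧ does (y ∈? S)) ∧ (diffMod m x y ≡ᵇ c % m))
        ≡⟨ sum-cong-≗ (λ x → sum-cong-≗ (λ y → 𝟙-∧∧ (does (x ∈? S)) (does (y ∈? S)) _)) ⟩
      ∑[ x < m ] ∑[ y < m ] diffIndicator (c % m) x y
        ≡⟨ cong (λ c′ → ∑[ x < m ] ∑[ y < m ] diffIndicator c′ x y) (m<n⇒m%n≡m c<m) ⟩
      ∑[ x < m ] ∑[ y < m ] diffIndicator c x y
        ∎
      where
      P? : Decidable _
      P? (x , y) = ((x ∈? S) ×-dec (y ∈? S)) ×-dec (diffMod m x y ≟ c % m)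
      𝟙-∧∧ : ∀ a b d → 𝟙 ((a ∧ b) ∧ d) ≡ 𝟙 a * 𝟙 b * 𝟙 d
      𝟙-∧∧ a b d = trans (𝟙-∧ (a ∧ b) d) (cong (_* 𝟙 d) (𝟙-∧ a b))

    repCount-zero : repCount m S 0 ≡ ∣ S ∣
    repCount-zero = begin
      repCount m S 0
        ≡⟨ repCount≡∑∑ (>-nonZero⁻¹ m) ⟩
      ∑[ x < m ] ∑[ y < m ] diffIndicator 0 x y
        ≡⟨ sum-cong-≗ (λ x → sum-cong-≗ (diffIndicator-diagonal x)) ⟩
      ∑[ x < m ] ∑[ y < m ] (𝟙 (toℕ x ≡ᵇ toℕ y) * (𝟙 (does (x ∈? S)) * 𝟙 (does (y ∈? S))))
        ≡⟨ sum-cong-≗ (λ x → trans (∑-select x _) (𝟙-idem (does (x ∈? S)))) ⟩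
      ∑[ x < m ] 𝟙 (does (x ∈? S))
        ≡⟨ ∑-𝟙-∈ S ⟩
      ∣ S ∣
        ∎
      where
      diffIndicator-diagonal : ∀ x y →
        diffIndicator 0 x y ≡ 𝟙 (toℕ x ≡ᵇ toℕ y) * (𝟙 (does (x ∈? S)) * 𝟙 (does (y ∈? S)))
      diffIndicator-diagonal x y = begin
        diffIndicator 0 x y
          ≡⟨ cong (λ b → 𝟙 (does (x ∈? S)) * 𝟙 (does (y ∈? S)) * 𝟙 b)
                  (does-⇔ diffMod≡0⇔ (diffMod m x y ≟ 0) (toℕ x ≟ toℕ y)) ⟩
        𝟙 (does (x ∈? S)) * 𝟙 (does (y ∈? S)) * 𝟙 (toℕ x ≡ᵇ toℕ y)
          ≡⟨ *-comm _ (𝟙 (toℕ x ≡ᵇ toℕ y)) ⟩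
        𝟙 (toℕ x ≡ᵇ toℕ y) * (𝟙 (does (x ∈? S)) * 𝟙 (does (y ∈? S)))
          ∎

    ∑-repCount : ∑[ a < m ] repCount m S (toℕ a) ≡ ∣ S ∣ * ∣ S ∣
    ∑-repCount = begin
      ∑[ a < m ] repCount m S (toℕ a)
        ≡⟨ sum-cong-≗ (λ a → repCount≡∑∑ (toℕ<n a)) ⟩
      ∑[ a < m ] ∑[ x < m ] ∑[ y < m ] diffIndicator (toℕ a) x y
        ≡⟨ ∑-comm (λ (a x : Fin m) → ∑[ y < m ] diffIndicator (toℕ a) x y) ⟩
      ∑[ x < m ] ∑[ a < m ] ∑[ y < m ] diffIndicator (toℕ a) x y
        ≡⟨ sum-cong-≗ (λ x → ∑-comm (λ (a y : Fin m) → diffIndicator (toℕ a) x y)) ⟩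
      ∑[ x < m ] ∑[ y < m ] ∑[ a < m ] diffIndicator (toℕ a) x y
        ≡⟨ sum-cong-≗ (λ x → sum-cong-≗ (λ y →
             sym (*-distribˡ-sum (𝟙 (does (x ∈? S)) * 𝟙 (does (y ∈? S)))
                                 (λ (a : Fin m) → 𝟙 (diffMod m x y ≡ᵇ toℕ a))))) ⟩
      ∑[ x < m ] ∑[ y < m ]
        (𝟙 (does (x ∈? S)) * 𝟙 (does (y ∈? S)) * ∑[ a < m ] 𝟙 (diffMod m x y ≡ᵇ toℕ a))
        ≡⟨ sum-cong-≗ (λ x → sum-cong-≗ (λ y → trans
             (cong (𝟙 (does (x ∈? S)) * 𝟙 (does (y ∈? S)) *_) (∑-𝟙-≡ᵇ (m%n<n _ m)))
             (*-identityʳ _))) ⟩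
      ∑[ x < m ] ∑[ y < m ] (𝟙 (does (x ∈? S)) * 𝟙 (does (y ∈? S)))
        ≡⟨ sum-cong-≗ (λ x →
             sym (*-distribˡ-sum (𝟙 (does (x ∈? S))) (λ (y : Fin m) → 𝟙 (does (y ∈? S))))) ⟩
      ∑[ x < m ] (𝟙 (does (x ∈? S)) * ∑[ y < m ] 𝟙 (does (y ∈? S)))
        ≡⟨ sym (*-distribʳ-sum (∑[ y < m ] 𝟙 (does (y ∈? S)))
                               (λ (x : Fin m) → 𝟙 (does (x ∈? S)))) ⟩
      (∑[ x < m ] 𝟙 (does (x ∈? S))) * ∑[ y < m ] 𝟙 (does (y ∈? S))
        ≡⟨ cong₂ _*_ (∑-𝟙-∈ S) (∑-𝟙-∈ S) ⟩
      ∣ S ∣ * ∣ S ∣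
        ∎

  module _ {m : ℕ} .{{_ : NonZero m}} (B D : Subset m) where

    N-zero : N m B D 0 ≡ ∣ B ∣ + ∣ D ∣
    N-zero = cong₂ _+_ (repCount-zero B) (repCount-zero D)

    ∑-N : ∑[ a < m ] N m B D (toℕ a) ≡ ∣ B ∣ * ∣ B ∣ + ∣ D ∣ * ∣ D ∣
    ∑-N = trans (∑-distrib-+ (λ (a : Fin m) → repCount m B (toℕ a)) (λ a → repCount m D (toℕ a)))
                (cong₂ _+_ (∑-repCount B) (∑-repCount D))

  ∑-N-nonzero : ∀ {m′} (B D : Subset (suc m′)) →
    ∣ B ∣ + ∣ D ∣ + ∑[ i < m′ ] N (suc m′) B D (suc (toℕ i)) ≡ ∣ B ∣ * ∣ B ∣ + ∣ D ∣ * ∣ D ∣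
  ∑-N-nonzero {m′} B D =
    trans (cong (_+ ∑[ i < m′ ] N (suc m′) B D (suc (toℕ i))) (sym (N-zero B D))) (∑-N B D)

  odd⇒suc≡2*half : ∀ m → m % 2 ≡ 1 → m + 1 ≡ 2 * ((m + 1) / 2)
  odd⇒suc≡2*half m m-odd = begin
    m + 1                          ≡⟨ m≡m%n+[m/n]*n (m + 1) 2 ⟩
    (m + 1) % 2 + (m + 1) / 2 * 2  ≡⟨ cong (_+ (m + 1) / 2 * 2) [m+1]%2≡0 ⟩
    (m + 1) / 2 * 2                ≡⟨ *-comm ((m + 1) / 2) 2 ⟩
    2 * ((m + 1) / 2)              ∎
    where
    [m+1]%2≡0 : (m + 1) % 2 ≡ 0
    [m+1]%2≡0 = trans (%-distribˡ-+ m 1 2) (cong (λ r → (r + 1 % 2) % 2) m-odd)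

open import Data.Integer.Base using (ℤ; +_; 0ℤ; _+_; _-_; _*_; _≤_)
open import Data.Integer.Properties
  using ( ≤-refl; ≤-reflexive; ≤-trans; +-mono-≤; +-monoʳ-≤; +-identityʳ; i≤i+j; i≤j⇒0≤j-i
        ; pos-*; suc-*; module ≤-Reasoning)
open import Data.Integer.Tactic.RingSolver using (solve-∀)

n*lo≤∑ : ∀ {n} {lo : ℤ} (f : Fin n → ℕ) → (∀ i → lo ≤ + f i) → + n * lo ≤ + (∑[ i < n ] f i)
n*lo≤∑ {zero}          f lo≤f = ≤-refl
n*lo≤∑ {suc n} {lo} f lo≤f = begin
  + suc n * lo               ≡⟨ suc-* (+ n) lo ⟩
  lo + + n * lo              ≤⟨ +-mono-≤ (lo≤f zero) (n*lo≤∑ (f ∘ suc) (lo≤f ∘ suc)) ⟩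
  + (∑[ i < suc n ] f i)     ∎
  where open ≤-Reasoning

∑≤n*hi : ∀ {n} {hi : ℤ} (f : Fin n → ℕ) → (∀ i → + f i ≤ hi) → + (∑[ i < n ] f i) ≤ + n * hi
∑≤n*hi {zero}          f f≤hi = ≤-refl
∑≤n*hi {suc n} {hi} f f≤hi = begin
  + (∑[ i < suc n ] f i)     ≤⟨ +-mono-≤ (f≤hi zero) (∑≤n*hi (f ∘ suc) (f≤hi ∘ suc)) ⟩
  hi + + n * hi              ≡⟨ suc-* (+ n) hi ⟨
  + suc n * hi               ∎
  where open ≤-Reasoning

≡⊎≡+1⇒≤×≤+1 : ∀ {i j : ℤ} → i ≡ j ⊎ i ≡ j + + 1 → j ≤ i × i ≤ j + + 1
≡⊎≡+1⇒≤×≤+1 {j = j} (inj₁ refl) = ≤-refl , i≤i+j j (+ 1)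
≡⊎≡+1⇒≤×≤+1 {j = j} (inj₂ refl) = i≤i+j j (+ 1) , ≤-refl

i≤i+[j+j] : ∀ i {j} → 0ℤ ≤ j → i ≤ i + (j + j)
i≤i+[j+j] i 0≤j = ≤-trans (≤-reflexive (sym (+-identityʳ i))) (+-monoʳ-≤ i (+-mono-≤ 0≤j 0≤j))

-- The two gaps are twice the slacks (m − 1)(s − h + 1) − T and T − (m − 1)(s − h) once m = 2h − 1.
quadratic-bounds : ∀ {m h s T Q : ℤ} → m ≡ + 2 * h - + 1 → s + T ≡ Q →
  (m - + 1) * (s - h) ≤ T → T ≤ (m - + 1) * (s - h + + 1) →
  ((m - + 1) * (m - + 1) ≤ + 2 * (s * m - Q)) × (+ 2 * (s * m - Q) ≤ m * m - + 1)
quadratic-bounds {h = h} {s} {T} refl refl lo hi =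
  ≤-trans (i≤i+[j+j] _ (i≤j⇒0≤j-i hi)) (≤-reflexive (sym (lower-gap h s T))) ,
  ≤-trans (i≤i+[j+j] _ (i≤j⇒0≤j-i lo)) (≤-reflexive (sym (upper-gap h s T)))
  where
  lower-gap : ∀ h s T → let m = + 2 * h - + 1 in
    + 2 * (s * m - (s + T))
      ≡ (m - + 1) * (m - + 1) + (((m - + 1) * (s - h + + 1) - T) + ((m - + 1) * (s - h + + 1) - T))
  lower-gap = solve-∀
  upper-gap : ∀ h s T → let m = + 2 * h - + 1 in
    m * m - + 1 ≡ + 2 * (s * m - (s + T)) + ((T - (m - + 1) * (s - h)) + (T - (m - + 1) * (s - h)))
  upper-gap = solve-∀

odd⇒≡2*half-1 : ∀ m → m % 2 ≡ 1 → + m ≡ + 2 * + ((m Data.Nat.+ 1) / 2) - + 1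
odd⇒≡2*half-1 m m-odd =
  trans (x≡x+1-1 (+ m))
        (cong (_- + 1) (trans (cong +_ (odd⇒suc≡2*half m m-odd)) (pos-* 2 ((m Data.Nat.+ 1) / 2))))
  where
  x≡x+1-1 : ∀ x → x ≡ x + + 1 - + 1
  x≡x+1-1 = solve-∀

corollary5 : (m : ℕ) .{{_ : NonZero m}} → m % 2 ≡ 1 →
    (k r : ℕ) (B D : Subset m) →
    IsASDS m B D k r (+ k + + r - + ((m Data.Nat.+ 1) / 2)) →
    (∀ (x : Fin m) → toℕ x ≡ 0 → x ∉ B) →
    (∀ (y : Fin m) → toℕ y ≡ m ∸ 1 → y ∉ D) →
    ((+ m - + 1) * (+ m - + 1) ≤ + 2 * ((+ k + + r) * + m - (+ k * + k + + r * + r)))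
    × (+ 2 * ((+ k + + r) * + m - (+ k * + k + + r * + r)) ≤ + m * + m - + 1)
corollary5 zero () _ _ _ _ _ _ _
corollary5 m@(suc m′) m-odd _ _ B D (refl , refl , N-near-μ) _ _ =
  quadratic-bounds {h = + h} {s} {+ T} (odd⇒≡2*half-1 m m-odd) s+T≡Q
    (n*lo≤∑ N′ (proj₁ ∘ N-bounds)) (∑≤n*hi N′ (proj₂ ∘ N-bounds))
  where
  h = (m Data.Nat.+ 1) / 2
  s = + ∣ B ∣ + + ∣ D ∣
  N′ : Fin m′ → ℕ
  N′ i = N m B D (suc (toℕ i))
  T = ∑[ i < m′ ] N′ i
  N-bounds : ∀ i → s - + h ≤ + N′ i × + N′ i ≤ s - + h + + 1
  N-bounds i = ≡⊎≡+1⇒≤×≤+1 (N-near-μ (suc i) λ ())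
  s+T≡Q : s + + T ≡ + ∣ B ∣ * + ∣ B ∣ + + ∣ D ∣ * + ∣ D ∣
  s+T≡Q = trans (cong +_ (∑-N-nonzero B D)) (cong₂ _+_ (pos-* ∣ B ∣ ∣ B ∣) (pos-* ∣ D ∣ ∣ D ∣))
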